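{- Let $\alpha,\beta\in\mathcal{NCP}(n)$ be such that $(\alpha,\beta)$ is admissible. Then $\alpha^2\ast_n\beta$ and $\alpha\ast_n\beta^2$ are noncrossing partitions of $[3n]$, and $$\alpha\circ\beta=\Big((\alpha^2\ast_n\beta)\vee\{\{1,2,3\},\dots,\{3n-2,3n-1,3n\}\}\Big)^{1/3}=\Big((\alpha^2\ast_n\beta)\vee\{\{2,3\},\{5,6\},\dots,\{3n-1,3n\}\}\Big)^{1/3}=\Big((\alpha\ast_n\beta^2)\vee\{\{1,2,3\},\dots,\{3n-2,3n-1,3n\}\}\Big)^{1/3}.$$
   Context: A partition of $[m]=\{1,\dots,m\}$ is noncrossing if there are no two distinct blocks $B,C$ and $a<b<c<d$ with $a,c\in B$, $b,d\in C$. $\mathcal{NCP}(m)$ is the lattice of noncrossing partitions of $[m]$ under refinement, with join $\vee$ (joins below are taken in $\mathcal{NCP}(3n)$ or $\mathcal{NCP}(2n)$ as appropriate). For $\pi\in\mathcal{NCP}(n)$ and $p\ge1$, the $p$-th power $\pi^p\in\mathcal{NCP}(pn)$ has blocks $\{(x-1)p+j:x\in B,\,1\le j\le p\}$ for $B$ a block of $\pi$. For $\alpha\in\mathcal{NCP}(kn)$, $\beta\in\mathcal{NCP}(ln)$, the $n$-perfect shuffle $\alpha\ast_n\beta$ is the partition $i_k(\alpha)\cup e_l(\beta)$ of $[(k+l)n]$, where $i_k(ak+j)=a(k+l)+j$ ($0\le a\le n-1$, $1\le j\le k$) and $e_l(al+j)=a(k+l)+k+j$ ($0\le a\le n-1$,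 $1\le j\le l$). For $\alpha,\beta\in\mathcal{NCP}(n)$ the pair is admissible if $\alpha\ast_n\beta$ is noncrossing. For $\gamma\in\mathcal{NCP}(kn)$ in which each $\{(i-1)k+1,\dots,ik\}$ lies in a single block, $\gamma^{1/k}\in\mathcal{NCP}(n)$ has blocks $\{i:ik\in D\}$, $D$ a block of $\gamma$. For an admissible pair, $\alpha\circ\beta:=\big((\alpha\ast_n\beta)\vee\{\{1,2\},\dots,\{2n-1,2n\}\}\big)^{1/2}$. -}

module Defs where

open import Data.Nat using (ℕ; zero; suc; _+_; _*_; _∸_; _≤_; _<_; _≡ᵇ_; NonZero)
open import Data.Nat.DivMod using (_/_; _%_)
open import Data.Bool using (Bool; true; false; T; _∧_; _∨_; not)
open import Data.Product using (_×_)
open import Data.Sum using (_⊎_; inj₁; inj₂)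

-- A (candidate) partition of [m] = {1,…,m} is encoded by a Boolean relation
-- on ℕ; only its values on [m] × [m] matter ("x and y lie in the same block").
BRel : Set
BRel = ℕ → ℕ → Bool

_∈[_] : ℕ → ℕ → Set
x ∈[ m ] = (1 ≤ x) × (x ≤ m)

record IsPartition (m : ℕ) (R : BRel) : Set where
  field
    reflexive  : ∀ x → x ∈[ m ] → T (R x x)
    symmetric  : ∀ x y → x ∈[ m ] → y ∈[ m ] → T (R x y) → T (R y x)
    transitive : ∀ x y z → x ∈[ m ] → y ∈[ m ] → z ∈[ m ] →
                 T (R x y) → T (R y z) → T (R x z)

IsNoncrossing : ℕ → BRel → Set
IsNoncrossing m R = ∀ a b c d → 1 ≤ a → a < b → b < c → c < d → d ≤ m →
  T (R a c) → T (R b d) → T (R a b)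

record IsNCP (m : ℕ) (R : BRel) : Set where
  field
    partition   : IsPartition m R
    noncrossing : IsNoncrossing m R

-- ⌈ x / p ⌉ for x ≥ 1 (the index of the length-p chunk containing x)
chunkIdx : (p : ℕ) → .{{NonZero p}} → ℕ → ℕ
chunkIdx p x = suc ((x ∸ 1) / p)

pow : (p : ℕ) → .{{NonZero p}} → BRel → BRel
pow p R x y = R (chunkIdx p x) (chunkIdx p y)

-- Position z ∈ [(k+l)n] of the n-perfect shuffle comes either from position
-- a k + j of α (inj₁) or from position a l + j of β (inj₂), where z = a(k+l)+j resp. a(k+l)+k+j.
shuffleSide : (k l : ℕ) → .{{NonZero (k + l)}} → ℕ → ℕ ⊎ ℕ
shuffleSide k l z with (z ∸ 1) / (k + l) | (z ∸ 1) % (k + l)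
... | a | r with r Data.Nat.<ᵇ k
...   | true  = inj₁ (a * k + suc r)
...   | false = inj₂ (a * l + suc (r ∸ k))

sameSideRel : BRel → BRel → ℕ ⊎ ℕ → ℕ ⊎ ℕ → Bool
sameSideRel α β (inj₁ i) (inj₁ j) = α i j
sameSideRel α β (inj₂ i) (inj₂ j) = β i j
sameSideRel α β _ _ = false

-- α ∗ₙ β = i_k(α) ∪ e_l(β) for α ∈ NCP(kn), β ∈ NCP(ln)
-- (n is only needed to fix the ground set [(k+l)n]; the relation does not depend on it)
shuffle : (k l : ℕ) → .{{NonZero (k + l)}} → (n : ℕ) → BRel → BRel → BRel
shuffle k l n α β x y = sameSideRel α β (shuffleSide k l x) (shuffleSide k l y)

Admissible : ℕ → BRel → BRel → Set
Admissible n α β = IsNoncrossing (2 * n) (shuffle 1 1 n α β)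

chunks : (k : ℕ) → .{{NonZero k}} → BRel
chunks k x y = chunkIdx k x ≡ᵇ chunkIdx k y

-- {{1},{2,3},{4},{5,6},…}: x ~ y iff x = y, or x, y are in the same triple
-- and neither is ≡ 1 (mod 3)
tailPairs3 : BRel
tailPairs3 x y = (x ≡ᵇ y) ∨ ((chunkIdx 3 x ≡ᵇ chunkIdx 3 y)
                   ∧ not ((x ∸ 1) % 3 ≡ᵇ 0) ∧ not ((y ∸ 1) % 3 ≡ᵇ 0))

_≤[_]_ : BRel → ℕ → BRel → Set
R ≤[ m ] S = ∀ x y → x ∈[ m ] → y ∈[ m ] → T (R x y) → T (S x y)

-- Join A ∨ B in the lattice NCP(m), as a block relation on [m]: the meet
-- (intersection) of all noncrossing partitions of [m] lying above A and B
-- (NCP(m) is a finite lattice; meets in NCP(m) are intersections).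
join : ℕ → BRel → BRel → ℕ → ℕ → Set
join m A B x y = x ∈[ m ] × y ∈[ m ] ×
  (∀ (σ : BRel) → IsNCP m σ → A ≤[ m ] σ → B ≤[ m ] σ → T (σ x y))

root : ℕ → (ℕ → ℕ → Set) → ℕ → ℕ → Set
root k γ i j = γ (i * k) (j * k)

ChunksInBlocks : ℕ → ℕ → (ℕ → ℕ → Set) → Set
ChunksInBlocks k n γ = ∀ i j → i ∈[ n ] → j ∈[ k ] → γ ((i ∸ 1) * k + j) (i * k)

_∘[_]_ : BRel → ℕ → BRel → ℕ → ℕ → Set
(α ∘[ n ] β) = root 2 (join (2 * n) (shuffle 1 1 n α β) (chunks 2))

_≈[_]_ : (ℕ → ℕ → Set) → ℕ → (ℕ → ℕ → Set) → Set
P ≈[ n ] Q = ∀ i j → i ∈[ n ] → j ∈[ n ] → (P i j → Q i j) × (Q i j → P i j)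

{-# OPTIONS --safe #-}
module Submission where

open import Defs
open import Data.Nat using (ℕ; _*_)
open import Data.Product using (_×_)
open import Data.Bool using (true; false; T)
open import Data.Bool.Properties using (T-∧; T-∨)
open import Data.Nat using (zero; suc; pred; _+_; _∸_; _≤_; _<_; _≤′_; _<ᵇ_; NonZero; z≤n; s≤s; z<s; s<s; ≤′-refl; ≤′-step)
open import Data.Nat.DivMod using (_/_; _%_; m≡m%n+[m/n]*n; m%n<n; +-distrib-/-∣ˡ; m*n/n≡m; m<n⇒m/n≡0; [m+kn]%n≡m%n; m<n⇒m%n≡m)
open import Data.Nat.Divisibility using (n∣m*n)
open import Data.Nat.Properties
open import Data.Product using (_,_; proj₁; proj₂)
open import Data.Sum as Sum using (_⊎_; inj₁; inj₂)
open import Data.Sum.Relation.Unary.All using (All; inj₁; inj₂)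
open import Data.Unit using (tt)
open import Function.Base using (id; _on_)
open import Function.Bundles using (Equivalence)
open import Relation.Binary.Core using (_Preserves_⟶_)
open import Relation.Binary.PropositionalEquality
open import Relation.Nullary using (contradiction)

-- α²∗β (resp. α∗β²) is the pullback of α∗β along the monotone map [3n] → [2n] sending the
-- triple 3a+1, 3a+2, 3a+3 onto the pair 2a+1, 2a+2 and merging the two positions that come
-- from α (resp. β); pullbacks along monotone maps preserve noncrossing partitions.
-- This map and its monotone section 2a+1 ↦ 3a+1, 2a+2 ↦ 3a+3 transport noncrossing upper
-- bounds both ways: pulling back along the map turns an upper bound of α∗β and the pairs
-- into one of α²∗β and the triples, and pulling back along the section does the converse,
-- provided every upper bound contains the triples. Hence the two joins correspond and
-- their roots agree. With {2,3}, {5,6}, … in place of the triples every upper bound still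
-- contains the triples, since 3a+1 and 3a+2 lie in one block of α²∗β.

-- Positions within blocks of consecutive integers

block-index< : ∀ k {n} a r → a * k + suc r ≤ k * n → a < n
block-index< k {n} a r le = *-cancelʳ-< k a n (begin-strict
  a * k          <⟨ m<m+n (a * k) z<s ⟩
  a * k + suc r  ≤⟨ le ⟩
  k * n          ≡⟨ *-comm k n ⟩
  n * k          ∎)
  where open ≤-Reasoning

block-∈ : ∀ k {n a r} → a < n → r < k → (a * k + suc r) ∈[ k * n ]
block-∈ k {n} {a} {r} a<n r<k = ≤-trans (s≤s z≤n) (m≤n+m (suc r) (a * k)) , (begin
  a * k + suc r  ≤⟨ +-monoʳ-≤ (a * k) r<k ⟩
  a * k + k      ≡⟨ +-comm (a * k) k ⟩
  suc a * k      ≤⟨ *-monoˡ-≤ k a<n ⟩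
  n * k          ≡⟨ *-comm n k ⟩
  k * n          ∎)
  where open ≤-Reasoning

module _ (k : ℕ) .{{_ : NonZero k}} where

  /-block : ∀ a {r} → r < k → (a * k + r) / k ≡ a
  /-block a {r} r<k = begin
    (a * k + r) / k    ≡⟨ +-distrib-/-∣ˡ r (n∣m*n a) ⟩
    a * k / k + r / k  ≡⟨ cong₂ _+_ (m*n/n≡m a k) (m<n⇒m/n≡0 r<k) ⟩
    a + 0              ≡⟨ +-identityʳ a ⟩
    a                  ∎
    where open ≡-Reasoning

  %-block : ∀ a {r} → r < k → (a * k + r) % k ≡ r
  %-block a {r} r<k = begin
    (a * k + r) % k  ≡⟨ cong (_% k) (+-comm (a * k) r) ⟩
    (r + a * k) % k  ≡⟨ [m+kn]%n≡m%n r a k ⟩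
    r % k            ≡⟨ m<n⇒m%n≡m r<k ⟩
    r                ∎
    where open ≡-Reasoning

  pred[k]<k : pred k < k
  pred[k]<k = subst (pred k <_) (suc-pred k) ≤-refl

  pred-block : ∀ a r → a * k + suc r ∸ 1 ≡ a * k + r
  pred-block a r = cong (_∸ 1) (+-suc (a * k) r)

  chunkIdx-block : ∀ a {r} → r < k → chunkIdx k (a * k + suc r) ≡ suc a
  chunkIdx-block a {r} r<k = cong suc (trans (cong (_/ k) (pred-block a r)) (/-block a r<k))

  last-block : ∀ a → suc a * k ≡ a * k + suc (pred k)
  last-block a = trans (+-comm k (a * k)) (cong (a * k +_) (sym (suc-pred k)))

  chunkIdx-last : ∀ a → chunkIdx k (suc a * k) ≡ suc a
  chunkIdx-last a = trans (cong (chunkIdx k) (last-block a)) (chunkIdx-block a pred[k]<k)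

  blockwise : (P : ℕ → Set) → (∀ a r → r < k → P (a * k + suc r)) → ∀ x → 1 ≤ x → P x
  blockwise P step (suc x) _ = subst P decompose (step (x / k) (x % k) (m%n<n x k))
    where
    decompose : x / k * k + suc (x % k) ≡ suc x
    decompose = begin
      x / k * k + suc (x % k)  ≡⟨ +-suc (x / k * k) (x % k) ⟩
      suc (x / k * k + x % k)  ≡⟨ cong suc (+-comm (x / k * k) (x % k)) ⟩
      suc (x % k + x / k * k)  ≡⟨ cong suc (m≡m%n+[m/n]*n x k) ⟨
      suc x                    ∎
      where open ≡-Reasoning

  last-∈ : ∀ {n a} → a < n → (suc a * k) ∈[ k * n ]
  last-∈ {n} {a} a<n = subst (_∈[ k * n ]) (sym (last-block a)) (block-∈ k a<n pred[k]<k)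

-- Pulling partitions back along monotone maps

Monotone : (ℕ → ℕ) → Set
Monotone h = h Preserves _≤_ ⟶ _≤_

monotone-step : (h : ℕ → ℕ) → (∀ x → h x ≤ h (suc x)) → Monotone h
monotone-step h step x≤y = go (≤⇒≤′ x≤y)
  where
  go : ∀ {x y} → x ≤′ y → h x ≤ h y
  go ≤′-refl       = ≤-refl
  go (≤′-step x≤y) = ≤-trans (go x≤y) (step _)

MapsInto : ℕ → ℕ → (ℕ → ℕ) → Set
MapsInto m m′ h = ∀ {x} → x ∈[ m ] → h x ∈[ m′ ]

monotone-mapsInto : ∀ {m m′} {h : ℕ → ℕ} → Monotone h → h 1 ≡ 1 → h m ≡ m′ → MapsInto m m′ h
monotone-mapsInto {h = h} mono h1 hm (1≤x , x≤m) =
  subst (_≤ h _) h1 (mono 1≤x) , subst (h _ ≤_) hm (mono x≤m)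

IsNCP-resp : ∀ {m} {R S : BRel} → (∀ x y → R x y ≡ S x y) → IsNCP m R → IsNCP m S
IsNCP-resp {m} {R} {S} R≗S ncp = record
  { partition = record
    { reflexive  = λ x x∈ → to (reflexive x x∈)
    ; symmetric  = λ x y x∈ y∈ Sxy → to (symmetric x y x∈ y∈ (from Sxy))
    ; transitive = λ x y z x∈ y∈ z∈ Sxy Syz → to (transitive x y z x∈ y∈ z∈ (from Sxy) (from Syz))
    }
  ; noncrossing = λ a b c d 1≤a a<b b<c c<d d≤m Sac Sbd →
      to (noncrossing a b c d 1≤a a<b b<c c<d d≤m (from Sac) (from Sbd))
  }
  where
  open IsNCP ncp
  open IsPartition partition
  to : ∀ {x y} → T (R x y) → T (S x y)
  to = subst T (R≗S _ _)
  from : ∀ {x y} → T (S x y) → T (R x y)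
  from = subst T (sym (R≗S _ _))

module _ {m m′ : ℕ} {h : ℕ → ℕ} (mono : Monotone h) (into : MapsInto m m′ h) where

  IsPartition-on : ∀ {R} → IsPartition m′ R → IsPartition m (R on h)
  IsPartition-on p = record
    { reflexive  = λ x x∈ → reflexive (h x) (into x∈)
    ; symmetric  = λ x y x∈ y∈ → symmetric (h x) (h y) (into x∈) (into y∈)
    ; transitive = λ x y z x∈ y∈ z∈ → transitive (h x) (h y) (h z) (into x∈) (into y∈) (into z∈)
    }
    where open IsPartition p

  IsNoncrossing-on : ∀ {R} → IsPartition m′ R → IsNoncrossing m′ R → IsNoncrossing m (R on h)
  IsNoncrossing-on {R} p nc a b c d 1≤a a<b b<c c<d d≤m Rac Rbd =
    cases (step a<b) (step b<c) (step c<d)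
    where
    open IsPartition p
    step : ∀ {x y} → x < y → h x < h y ⊎ h x ≡ h y
    step x<y = m≤n⇒m<n∨m≡n (mono (<⇒≤ x<y))
    c≤m : c ≤ m
    c≤m = ≤-trans (<⇒≤ c<d) d≤m
    b≤m : b ≤ m
    b≤m = ≤-trans (<⇒≤ b<c) c≤m
    a∈ : a ∈[ m ]
    a∈ = 1≤a , ≤-trans (<⇒≤ a<b) b≤m
    b∈ : b ∈[ m ]
    b∈ = ≤-trans 1≤a (<⇒≤ a<b) , b≤m
    c∈ : c ∈[ m ]
    c∈ = ≤-trans (proj₁ b∈) (<⇒≤ b<c) , c≤m
    d∈ : d ∈[ m ]
    d∈ = ≤-trans (proj₁ c∈) (<⇒≤ c<d) , d≤m
    cases : h a < h b ⊎ h a ≡ h b → h b < h c ⊎ h b ≡ h c → h c < h d ⊎ h c ≡ h d →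
            T (R (h a) (h b))
    cases (inj₂ ha≡hb) _ _ = subst (λ t → T (R (h a) t)) ha≡hb (reflexive (h a) (into a∈))
    cases (inj₁ _) (inj₂ hb≡hc) _ = subst (λ t → T (R (h a) t)) (sym hb≡hc) Rac
    cases (inj₁ _) (inj₁ _) (inj₂ hc≡hd) =
      transitive (h a) (h c) (h b) (into a∈) (into c∈) (into b∈) Rac
        (symmetric (h b) (h c) (into b∈) (into c∈) (subst (λ t → T (R (h b) t)) (sym hc≡hd) Rbd))
    cases (inj₁ ha<hb) (inj₁ hb<hc) (inj₁ hc<hd) =
      nc (h a) (h b) (h c) (h d) (proj₁ (into a∈)) ha<hb hb<hc hc<hd (proj₂ (into d∈)) Rac Rbd

  IsNCP-on : ∀ {R} → IsNCP m′ R → IsNCP m (R on h)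
  IsNCP-on ncp = record
    { partition   = IsPartition-on partition
    ; noncrossing = IsNoncrossing-on partition noncrossing
    }
    where open IsNCP ncp

-- Joins in NCP(m) and their roots

BelowJoin : ℕ → BRel → BRel → BRel → Set
BelowJoin m A B C = ∀ σ → IsNCP m σ → A ≤[ m ] σ → B ≤[ m ] σ → C ≤[ m ] σ

join-transport : ∀ {m m′} {h : ℕ → ℕ} {A B A′ B′ : BRel} → Monotone h → MapsInto m m′ h →
  (∀ σ → IsNCP m′ σ → A′ ≤[ m′ ] σ → B′ ≤[ m′ ] σ → A ≤[ m ] (σ on h) × B ≤[ m ] (σ on h)) →
  ∀ {x y} → join m A B x y → join m′ A′ B′ (h x) (h y)
join-transport mono into pull (x∈ , y∈ , below) =
  into x∈ , into y∈ , λ σ ncp A′≤σ B′≤σ →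
    below _ (IsNCP-on mono into ncp) (proj₁ (pull σ ncp A′≤σ B′≤σ)) (proj₂ (pull σ ncp A′≤σ B′≤σ))

module _ (k : ℕ) .{{_ : NonZero k}} {n : ℕ} where

  chunksInBlocks : ∀ {A B} → BelowJoin (k * n) A B (chunks k) → ChunksInBlocks k n (join (k * n) A B)
  chunksInBlocks below zero    _       (() , _) _
  chunksInBlocks below (suc a) zero    _        (() , _)
  chunksInBlocks below (suc a) (suc r) (_ , a<n) (_ , r<k) =
    x∈ , y∈ , λ σ ncp A≤σ B≤σ → below σ ncp A≤σ B≤σ _ _ x∈ y∈
      (≡⇒≡ᵇ _ _ (trans (chunkIdx-block k a r<k) (sym (chunkIdx-last k a))))
    where
    x∈ : (a * k + suc r) ∈[ k * n ]
    x∈ = block-∈ k a<n r<k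
    y∈ : (suc a * k) ∈[ k * n ]
    y∈ = last-∈ k a<n

  chunks≤-via-last : ∀ {σ} → IsPartition (k * n) σ →
    (∀ a r → a < n → r < k → T (σ (a * k + suc r) (suc a * k))) → chunks k ≤[ k * n ] σ
  chunks≤-via-last {σ} p link x y x∈ y∈ same =
    transitive x (last x) y x∈ (last-∈′ x x∈) y∈ (to-last x x∈)
      (symmetric y (last x) y∈ (last-∈′ x x∈) (subst (λ c → T (σ y (c * k))) same-chunk (to-last y y∈)))
    where
    open IsPartition p
    same-chunk : chunkIdx k y ≡ chunkIdx k x
    same-chunk = sym (≡ᵇ⇒≡ (chunkIdx k x) (chunkIdx k y) same)
    last : ℕ → ℕ
    last x = chunkIdx k x * k
    Last : ℕ → Set
    Last x = x ≤ k * n → last x ∈[ k * n ] × T (σ x (last x))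
    block : ∀ a r → r < k → Last (a * k + suc r)
    block a r r<k x≤kn =
      subst (λ c → (c * k) ∈[ k * n ] × T (σ (a * k + suc r) (c * k))) (sym (chunkIdx-block k a r<k))
        (last-∈ k a<n , link a r a<n r<k)
      where
      a<n : a < n
      a<n = block-index< k a r x≤kn
    last-∈′ : ∀ x → x ∈[ k * n ] → last x ∈[ k * n ]
    last-∈′ x (1≤x , x≤kn) = proj₁ (blockwise k Last block x 1≤x x≤kn)
    to-last : ∀ x → x ∈[ k * n ] → T (σ x (last x))
    to-last x (1≤x , x≤kn) = proj₂ (blockwise k Last block x 1≤x x≤kn)

record ChunkCollapse (k l n : ℕ) .{{_ : NonZero k}} .{{_ : NonZero l}} : Set where
  field
    collapse expand   : ℕ → ℕ
    collapse-monotone : Monotone collapse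
    expand-monotone   : Monotone expand
    collapse-into     : MapsInto (l * n) (k * n) collapse
    expand-into       : MapsInto (k * n) (l * n) expand
    collapse-expand   : ∀ x → collapse (expand x) ≡ x
    collapse-chunkIdx : ∀ x → chunkIdx k (collapse x) ≡ chunkIdx l x
    collapse-last     : ∀ i → collapse (i * l) ≡ i * k
    expand-last       : ∀ i → expand (i * k) ≡ i * l

module _ {k l n : ℕ} .{{_ : NonZero k}} .{{_ : NonZero l}} (C : ChunkCollapse k l n) where
  open ChunkCollapse C

  expand-chunkIdx : ∀ x → chunkIdx l (expand x) ≡ chunkIdx k x
  expand-chunkIdx x = trans (sym (collapse-chunkIdx (expand x))) (cong (chunkIdx k) (collapse-expand x))

  IsNCP-collapse : ∀ {R S} → IsNCP (k * n) R → (∀ x y → S x y ≡ R (collapse x) (collapse y)) →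
                   IsNCP (l * n) S
  IsNCP-collapse ncp S≗R = IsNCP-resp (λ x y → sym (S≗R x y)) (IsNCP-on collapse-monotone collapse-into ncp)

  root-join-collapse : ∀ {S A B} → (∀ x y → A x y ≡ S (collapse x) (collapse y)) →
    B ≤[ l * n ] chunks l → BelowJoin (l * n) A B (chunks l) →
    root k (join (k * n) S (chunks k)) ≈[ n ] root l (join (l * n) A B)
  root-join-collapse {S} {A} {B} A≗S B≤chunks chunked i j _ _ =
    (λ J → subst₂ (join (l * n) A B) (expand-last i) (expand-last j)
             (join-transport expand-monotone expand-into expand-bounds J))
    , (λ J → subst₂ (join (k * n) S (chunks k)) (collapse-last i) (collapse-last j)
             (join-transport collapse-monotone collapse-into collapse-bounds J))
    where
    expand-bounds : ∀ σ → IsNCP (l * n) σ → A ≤[ l * n ] σ → B ≤[ l * n ] σ →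
                    S ≤[ k * n ] (σ on expand) × chunks k ≤[ k * n ] (σ on expand)
    expand-bounds σ ncp A≤σ B≤σ =
      (λ x y x∈ y∈ Sxy → A≤σ _ _ (expand-into x∈) (expand-into y∈)
         (subst T (sym (trans (A≗S _ _) (cong₂ S (collapse-expand x) (collapse-expand y)))) Sxy))
      , λ x y x∈ y∈ same → chunked σ ncp A≤σ B≤σ _ _ (expand-into x∈) (expand-into y∈)
         (≡⇒≡ᵇ _ _ (trans (expand-chunkIdx x) (trans (≡ᵇ⇒≡ (chunkIdx k x) _ same) (sym (expand-chunkIdx y)))))
    collapse-bounds : ∀ τ → IsNCP (k * n) τ → S ≤[ k * n ] τ → chunks k ≤[ k * n ] τ →
                      A ≤[ l * n ] (τ on collapse) × B ≤[ l * n ] (τ on collapse)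
    collapse-bounds τ _ S≤τ chunks≤τ =
      (λ x y x∈ y∈ Axy → S≤τ _ _ (collapse-into x∈) (collapse-into y∈) (subst T (A≗S x y) Axy))
      , λ x y x∈ y∈ Bxy → chunks≤τ _ _ (collapse-into x∈) (collapse-into y∈)
         (≡⇒≡ᵇ _ _ (trans (collapse-chunkIdx x)
           (trans (≡ᵇ⇒≡ (chunkIdx l x) _ (B≤chunks x y x∈ y∈ Bxy)) (sym (collapse-chunkIdx y)))))

-- squeeze m maps the triple 3a+1, 3a+2, 3a+3 onto 2a+1, 2a+1+m, 2a+2, so the middle
-- position joins the first (m = 0) or the last (m = 1) one; spread is a common section.
squeeze : ℕ → ℕ → ℕ
squeeze m 0 = 0
squeeze m 1 = 1
squeeze m 2 = suc m
squeeze m (suc (suc (suc x))) = 2 + squeeze m x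

spread : ℕ → ℕ
spread 0 = 0
spread 1 = 1
spread (suc (suc x)) = 3 + spread x

squeeze-shift : ∀ {m} a x → squeeze m (a * 3 + x) ≡ a * 2 + squeeze m x
squeeze-shift zero    x = refl
squeeze-shift (suc a) x = cong (2 +_) (squeeze-shift a x)

squeeze-last : ∀ {m} i → squeeze m (i * 3) ≡ i * 2
squeeze-last zero    = refl
squeeze-last (suc i) = cong (2 +_) (squeeze-last i)

squeeze-spread : ∀ {m} x → squeeze m (spread x) ≡ x
squeeze-spread 0 = refl
squeeze-spread 1 = refl
squeeze-spread (suc (suc x)) = cong (2 +_) (squeeze-spread x)

module _ {m : ℕ} (m<2 : m < 2) where

  squeeze-monotone : Monotone (squeeze m)
  squeeze-monotone = monotone-step (squeeze m) step
    where
    step : ∀ x → squeeze m x ≤ squeeze m (suc x)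
    step 0 = z≤n
    step 1 = s≤s z≤n
    step 2 = m<2
    step (suc (suc (suc x))) = +-monoʳ-≤ 2 (step x)

  squeeze-chunkIdx : ∀ x → chunkIdx 2 (squeeze m x) ≡ chunkIdx 3 x
  squeeze-chunkIdx zero    = refl
  squeeze-chunkIdx (suc x) = blockwise 3 SameChunk same-chunk (suc x) (s≤s z≤n)
    where
    SameChunk : ℕ → Set
    SameChunk x = chunkIdx 2 (squeeze m x) ≡ chunkIdx 3 x
    via : ∀ a {r r′} → r < 3 → r′ < 2 → squeeze m (suc r) ≡ suc r′ → SameChunk (a * 3 + suc r)
    via a {r} {r′} r<3 r′<2 eq = begin
      chunkIdx 2 (squeeze m (a * 3 + suc r))  ≡⟨ cong (chunkIdx 2) (squeeze-shift a (suc r)) ⟩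
      chunkIdx 2 (a * 2 + squeeze m (suc r))  ≡⟨ cong (λ t → chunkIdx 2 (a * 2 + t)) eq ⟩
      chunkIdx 2 (a * 2 + suc r′)             ≡⟨ chunkIdx-block 2 a r′<2 ⟩
      suc a                                   ≡⟨ chunkIdx-block 3 a r<3 ⟨
      chunkIdx 3 (a * 3 + suc r)              ∎
      where open ≡-Reasoning
    same-chunk : ∀ a r → r < 3 → SameChunk (a * 3 + suc r)
    same-chunk a 0 r<3 = via a r<3 (s≤s z≤n) refl
    same-chunk a 1 r<3 = via a r<3 m<2 refl
    same-chunk a 2 r<3 = via a r<3 ≤-refl refl
    same-chunk a (suc (suc (suc _))) (s≤s (s≤s (s≤s ())))

spread-monotone : Monotone spread
spread-monotone = monotone-step spread step
  where
  step : ∀ x → spread x ≤ spread (suc x)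
  step 0 = z≤n
  step 1 = s≤s z≤n
  step (suc (suc x)) = +-monoʳ-≤ 3 (step x)

spread-last : ∀ i → spread (i * 2) ≡ i * 3
spread-last zero    = refl
spread-last (suc i) = cong (3 +_) (spread-last i)

squeeze-collapse : ∀ {m} → m < 2 → ∀ n → ChunkCollapse 2 3 n
squeeze-collapse {m} m<2 n = record
  { collapse          = squeeze m
  ; expand            = spread
  ; collapse-monotone = squeeze-monotone m<2
  ; expand-monotone   = spread-monotone
  ; collapse-into     = monotone-mapsInto (squeeze-monotone m<2) refl (rescale (squeeze m) squeeze-last)
  ; expand-into       = monotone-mapsInto spread-monotone refl (rescale spread spread-last)
  ; collapse-expand   = squeeze-spread
  ; collapse-chunkIdx = squeeze-chunkIdx m<2
  ; collapse-last     = squeeze-last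
  ; expand-last       = spread-last
  }
  where
  rescale : ∀ (h : ℕ → ℕ) {k l} → (∀ i → h (i * k) ≡ i * l) → h (k * n) ≡ l * n
  rescale h {k} {l} h-last = trans (cong h (*-comm k n)) (trans (h-last n) (*-comm n l))

-- Perfect shuffles

data Offset (k l : ℕ) : ℕ → Set where
  left  : ∀ {r} → r < k → Offset k l r
  right : ∀ {r} → r < l → Offset k l (k + r)

offset : ∀ k l {r} → r < k + l → Offset k l r
offset zero    l         r<l         = right r<l
offset (suc k) l {zero}  _           = left z<s
offset (suc k) l {suc r} (s≤s r<k+l) with offset k l r<k+l
... | left r<k  = left (s≤s r<k)
... | right r<l = right r<l

module _ (k l : ℕ) .{{_ : NonZero (k + l)}} where

  shuffleSide-left : ∀ a {r} → r < k → shuffleSide k l (a * (k + l) + suc r) ≡ inj₁ (a * k + suc r)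
  shuffleSide-left a {r} r<k
    rewrite +-suc (a * (k + l)) r
          | /-block (k + l) a (≤-trans r<k (m≤m+n k l))
          | %-block (k + l) a (≤-trans r<k (m≤m+n k l))
    with r <ᵇ k | <⇒<ᵇ r<k
  ... | true | _ = refl

  shuffleSide-right : ∀ a {r} → r < l → shuffleSide k l (a * (k + l) + suc (k + r)) ≡ inj₂ (a * l + suc r)
  shuffleSide-right a {r} r<l
    rewrite +-suc (a * (k + l)) (k + r)
          | /-block (k + l) a (+-monoʳ-< k r<l)
          | %-block (k + l) a (+-monoʳ-< k r<l)
    with k + r <ᵇ k | <ᵇ⇒< (k + r) k
  ... | false | _     = cong (λ t → inj₂ (a * l + suc t)) (m+n∸m≡n k r)
  ... | true  | k+r<k = contradiction (k+r<k tt) (m+n≮m k r)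

  shuffleSide-∈ : ∀ {n x} → x ∈[ (k + l) * n ] → All (_∈[ k * n ]) (_∈[ l * n ]) (shuffleSide k l x)
  shuffleSide-∈ {n} {x} (1≤x , x≤) = blockwise (k + l) OnSides on-sides x 1≤x x≤
    where
    OnSides : ℕ → Set
    OnSides x = x ≤ (k + l) * n → All (_∈[ k * n ]) (_∈[ l * n ]) (shuffleSide k l x)
    on-sides : ∀ a r → r < k + l → OnSides (a * (k + l) + suc r)
    on-sides a r r<k+l x≤ with offset k l r<k+l
    ... | left r<k rewrite shuffleSide-left a r<k =
      inj₁ (block-∈ k (block-index< (k + l) a r x≤) r<k)
    ... | right {r′} r′<l rewrite shuffleSide-right a r′<l =
      inj₂ (block-∈ l (block-index< (k + l) a (k + r′) x≤) r′<l)

module _ {m₁ m₂ : ℕ} {α β : BRel} (pα : IsPartition m₁ α) (pβ : IsPartition m₂ β) where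
  private
    module A = IsPartition pα
    module B = IsPartition pβ

  sameSideRel-refl : ∀ {u} → All (_∈[ m₁ ]) (_∈[ m₂ ]) u → T (sameSideRel α β u u)
  sameSideRel-refl (inj₁ i∈) = A.reflexive _ i∈
  sameSideRel-refl (inj₂ i∈) = B.reflexive _ i∈

  sameSideRel-sym : ∀ {u v} → All (_∈[ m₁ ]) (_∈[ m₂ ]) u → All (_∈[ m₁ ]) (_∈[ m₂ ]) v →
                    T (sameSideRel α β u v) → T (sameSideRel α β v u)
  sameSideRel-sym (inj₁ i∈) (inj₁ j∈) = A.symmetric _ _ i∈ j∈
  sameSideRel-sym (inj₂ i∈) (inj₂ j∈) = B.symmetric _ _ i∈ j∈

  sameSideRel-trans : ∀ {u v w} → All (_∈[ m₁ ]) (_∈[ m₂ ]) u → All (_∈[ m₁ ]) (_∈[ m₂ ]) v →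
                      All (_∈[ m₁ ]) (_∈[ m₂ ]) w →
                      T (sameSideRel α β u v) → T (sameSideRel α β v w) → T (sameSideRel α β u w)
  sameSideRel-trans (inj₁ i∈) (inj₁ j∈) (inj₁ k∈) = A.transitive _ _ _ i∈ j∈ k∈
  sameSideRel-trans (inj₂ i∈) (inj₂ j∈) (inj₂ k∈) = B.transitive _ _ _ i∈ j∈ k∈

shuffle-isPartition : ∀ {k l n} .{{_ : NonZero (k + l)}} {α β} →
  IsPartition (k * n) α → IsPartition (l * n) β → IsPartition ((k + l) * n) (shuffle k l n α β)
shuffle-isPartition {k} {l} {n} pα pβ = record
  { reflexive  = λ x x∈ → sameSideRel-refl pα pβ (side-∈ x∈)
  ; symmetric  = λ x y x∈ y∈ → sameSideRel-sym pα pβ (side-∈ x∈) (side-∈ y∈)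
  ; transitive = λ x y z x∈ y∈ z∈ → sameSideRel-trans pα pβ (side-∈ x∈) (side-∈ y∈) (side-∈ z∈)
  }
  where
  side-∈ : ∀ {x} → x ∈[ (k + l) * n ] → All (_∈[ k * n ]) (_∈[ l * n ]) (shuffleSide k l x)
  side-∈ = shuffleSide-∈ k l

sameSideRel-on : ∀ α β (φ ψ : ℕ → ℕ) u v →
  sameSideRel (α on φ) (β on ψ) u v ≡ sameSideRel α β (Sum.map φ ψ u) (Sum.map φ ψ v)
sameSideRel-on α β φ ψ (inj₁ _) (inj₁ _) = refl
sameSideRel-on α β φ ψ (inj₁ _) (inj₂ _) = refl
sameSideRel-on α β φ ψ (inj₂ _) (inj₁ _) = refl
sameSideRel-on α β φ ψ (inj₂ _) (inj₂ _) = refl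

a*1+1≡1+a : ∀ a → a * 1 + 1 ≡ suc a
a*1+1≡1+a a = trans (+-comm (a * 1) 1) (cong suc (*-identityʳ a))

shuffleSide₁₁-odd : ∀ a → shuffleSide 1 1 (a * 2 + 1) ≡ inj₁ (suc a)
shuffleSide₁₁-odd a = trans (shuffleSide-left 1 1 a z<s) (cong inj₁ (a*1+1≡1+a a))

shuffleSide₁₁-even : ∀ a → shuffleSide 1 1 (a * 2 + 2) ≡ inj₂ (suc a)
shuffleSide₁₁-even a = trans (shuffleSide-right 1 1 a z<s) (cong inj₂ (a*1+1≡1+a a))

shuffleSide₂₁-squeeze : ∀ x → Sum.map (chunkIdx 2) id (shuffleSide 2 1 x) ≡ shuffleSide 1 1 (squeeze 0 x)
shuffleSide₂₁-squeeze zero    = refl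
shuffleSide₂₁-squeeze (suc x) = blockwise 3 Agree agree (suc x) (s≤s z≤n)
  where
  Agree : ℕ → Set
  Agree x = Sum.map (chunkIdx 2) id (shuffleSide 2 1 x) ≡ shuffleSide 1 1 (squeeze 0 x)
  agree : ∀ a r → r < 3 → Agree (a * 3 + suc r)
  agree a 0 _ rewrite shuffleSide-left 2 1 a {0} z<s | squeeze-shift {0} a 1 | shuffleSide₁₁-odd a =
    cong inj₁ (chunkIdx-block 2 a z<s)
  agree a 1 _ rewrite shuffleSide-left 2 1 a {1} (s<s z<s) | squeeze-shift {0} a 2 | shuffleSide₁₁-odd a =
    cong inj₁ (chunkIdx-block 2 a (s<s z<s))
  agree a 2 _ rewrite shuffleSide-right 2 1 a {0} z<s | squeeze-shift {0} a 3 =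
    sym (shuffleSide-right 1 1 a z<s)
  agree a (suc (suc (suc _))) (s≤s (s≤s (s≤s ())))

shuffleSide₁₂-squeeze : ∀ x → Sum.map id (chunkIdx 2) (shuffleSide 1 2 x) ≡ shuffleSide 1 1 (squeeze 1 x)
shuffleSide₁₂-squeeze zero    = refl
shuffleSide₁₂-squeeze (suc x) = blockwise 3 Agree agree (suc x) (s≤s z≤n)
  where
  Agree : ℕ → Set
  Agree x = Sum.map id (chunkIdx 2) (shuffleSide 1 2 x) ≡ shuffleSide 1 1 (squeeze 1 x)
  agree : ∀ a r → r < 3 → Agree (a * 3 + suc r)
  agree a 0 _ rewrite shuffleSide-left 1 2 a {0} z<s | squeeze-shift {1} a 1 =
    sym (shuffleSide-left 1 1 a z<s)
  agree a 1 _ rewrite shuffleSide-right 1 2 a {0} z<s | squeeze-shift {1} a 2 | shuffleSide₁₁-even a =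
    cong inj₂ (chunkIdx-block 2 a z<s)
  agree a 2 _ rewrite shuffleSide-right 1 2 a {1} (s<s z<s) | squeeze-shift {1} a 3 | shuffleSide₁₁-even a =
    cong inj₂ (chunkIdx-block 2 a (s<s z<s))
  agree a (suc (suc (suc _))) (s≤s (s≤s (s≤s ())))

shuffle₂₁-squeeze : ∀ n α β x y →
  shuffle 2 1 n (pow 2 α) β x y ≡ shuffle 1 1 n α β (squeeze 0 x) (squeeze 0 y)
shuffle₂₁-squeeze n α β x y =
  trans (sameSideRel-on α β (chunkIdx 2) id (shuffleSide 2 1 x) (shuffleSide 2 1 y))
        (cong₂ (sameSideRel α β) (shuffleSide₂₁-squeeze x) (shuffleSide₂₁-squeeze y))

shuffle₁₂-squeeze : ∀ n α β x y →
  shuffle 1 2 n α (pow 2 β) x y ≡ shuffle 1 1 n α β (squeeze 1 x) (squeeze 1 y)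
shuffle₁₂-squeeze n α β x y =
  trans (sameSideRel-on α β id (chunkIdx 2) (shuffleSide 1 2 x) (shuffleSide 1 2 y))
        (cong₂ (sameSideRel α β) (shuffleSide₁₂-squeeze x) (shuffleSide₁₂-squeeze y))

tailPairs3≤chunks3 : ∀ m → tailPairs3 ≤[ m ] chunks 3
tailPairs3≤chunks3 m x y _ _ t with Equivalence.to T-∨ t
... | inj₁ x≡ᵇy = ≡⇒≡ᵇ _ _ (cong (chunkIdx 3) (≡ᵇ⇒≡ x y x≡ᵇy))
... | inj₂ rest = proj₁ (Equivalence.to T-∧ rest)

tailPairs3-block : ∀ a → T (tailPairs3 (a * 3 + 2) (a * 3 + 3))
tailPairs3-block a
  rewrite pred-block 3 a 1 | pred-block 3 a 2
        | /-block 3 a {1} (s<s z<s) | /-block 3 a {2} (s<s (s<s z<s))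
        | %-block 3 a {1} (s<s z<s) | %-block 3 a {2} (s<s (s<s z<s))
  = Equivalence.from T-∨ (inj₂ (Equivalence.from T-∧ (≡⇒≡ᵇ a a refl , tt)))

tailPairs3-chunked : ∀ {n S} → (∀ a → a < n → T (S (a * 3 + 1) (a * 3 + 2))) →
  BelowJoin (3 * n) S tailPairs3 (chunks 3)
tailPairs3-chunked {n} {S} S-link σ ncp S≤σ tail≤σ = chunks≤-via-last 3 partition link
  where
  open IsNCP ncp
  open IsPartition partition
  link : ∀ a r → a < n → r < 3 → T (σ (a * 3 + suc r) (suc a * 3))
  link a r a<n r<3 = subst (λ t → T (σ (a * 3 + suc r) t)) (sym (last-block 3 a)) (to-third r r<3)
    where
    first∈ : (a * 3 + 1) ∈[ 3 * n ]
    first∈ = block-∈ 3 a<n z<s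
    second∈ : (a * 3 + 2) ∈[ 3 * n ]
    second∈ = block-∈ 3 a<n (s<s z<s)
    third∈ : (a * 3 + 3) ∈[ 3 * n ]
    third∈ = block-∈ 3 a<n (s<s (s<s z<s))
    second~third : T (σ (a * 3 + 2) (a * 3 + 3))
    second~third = tail≤σ _ _ second∈ third∈ (tailPairs3-block a)
    to-third : ∀ r → r < 3 → T (σ (a * 3 + suc r) (a * 3 + 3))
    to-third 0 _ = transitive _ _ _ first∈ second∈ third∈ (S≤σ _ _ first∈ second∈ (S-link a a<n)) second~third
    to-third 1 _ = second~third
    to-third 2 _ = reflexive _ third∈
    to-third (suc (suc (suc _))) (s≤s (s≤s (s≤s ())))

lemma3p19 : (n : ℕ) (α β : BRel) → IsNCP n α → IsNCP n β → Admissible n α β →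
    IsNCP (3 * n) (shuffle 2 1 n (pow 2 α) β)
    × IsNCP (3 * n) (shuffle 1 2 n α (pow 2 β))
    × ChunksInBlocks 3 n (join (3 * n) (shuffle 2 1 n (pow 2 α) β) (chunks 3))
    × ChunksInBlocks 3 n (join (3 * n) (shuffle 2 1 n (pow 2 α) β) tailPairs3)
    × ChunksInBlocks 3 n (join (3 * n) (shuffle 1 2 n α (pow 2 β)) (chunks 3))
    × ((α ∘[ n ] β) ≈[ n ] root 3 (join (3 * n) (shuffle 2 1 n (pow 2 α) β) (chunks 3)))
    × ((α ∘[ n ] β) ≈[ n ] root 3 (join (3 * n) (shuffle 2 1 n (pow 2 α) β) tailPairs3))
    × ((α ∘[ n ] β) ≈[ n ] root 3 (join (3 * n) (shuffle 1 2 n α (pow 2 β)) (chunks 3)))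
lemma3p19 n α β α-ncp β-ncp adm =
    IsNCP-collapse C₂₁ ncp₁₁ (shuffle₂₁-squeeze n α β)
  , IsNCP-collapse C₁₂ ncp₁₁ (shuffle₁₂-squeeze n α β)
  , chunksInBlocks 3 chunks3-below
  , chunksInBlocks 3 tailPairs3-below
  , chunksInBlocks 3 chunks3-below
  , root-join-collapse C₂₁ (shuffle₂₁-squeeze n α β) (λ _ _ _ _ → id) chunks3-below
  , root-join-collapse C₂₁ (shuffle₂₁-squeeze n α β) (tailPairs3≤chunks3 (3 * n)) tailPairs3-below
  , root-join-collapse C₁₂ (shuffle₁₂-squeeze n α β) (λ _ _ _ _ → id) chunks3-below
  where
  C₂₁ C₁₂ : ChunkCollapse 2 3 n
  C₂₁ = squeeze-collapse {0} z<s n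
  C₁₂ = squeeze-collapse {1} (s<s z<s) n

  ncp₁₁ : IsNCP (2 * n) (shuffle 1 1 n α β)
  ncp₁₁ = record { partition = shuffle-isPartition (on-1*n α-ncp) (on-1*n β-ncp) ; noncrossing = adm }
    where
    on-1*n : ∀ {γ} → IsNCP n γ → IsPartition (1 * n) γ
    on-1*n {γ} ncp = subst (λ m → IsPartition m γ) (sym (*-identityˡ n)) (IsNCP.partition ncp)

  chunks3-below : ∀ {A} → BelowJoin (3 * n) A (chunks 3) (chunks 3)
  chunks3-below _ _ _ chunks≤σ = chunks≤σ

  firstTwo-related : ∀ a → a < n → T (shuffle 2 1 n (pow 2 α) β (a * 3 + 1) (a * 3 + 2))
  firstTwo-related a a<n =
    subst T (sym (shuffle₂₁-squeeze n α β (a * 3 + 1) (a * 3 + 2)))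
      (subst₂ (λ x y → T (shuffle 1 1 n α β x y)) (sym (squeeze-shift a 1)) (sym (squeeze-shift a 2))
        (IsPartition.reflexive (IsNCP.partition ncp₁₁) (a * 2 + 1) (block-∈ 2 a<n z<s)))

  tailPairs3-below : BelowJoin (3 * n) (shuffle 2 1 n (pow 2 α) β) tailPairs3 (chunks 3)
  tailPairs3-below = tailPairs3-chunked firstTwo-related
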